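{- Let $\mathcal{D}$ be a symmetric $2$-$(56,11,2)$ design (biplane) and let $S$ be the set of all $(0,1)$-vectors of weight $12$ in the dual code $L^\perp$, where $L$ is the linear code over $GF(3)$ of length $56$ spanned by the rows of the points-by-blocks incidence matrix of $\mathcal{D}$ (coordinates indexed by the blocks of $\mathcal{D}$). Let $B$ be a block of $\mathcal{D}$ and $\mathcal{D}_B$ the residual $2$-$(45,9,2)$ design of $\mathcal{D}$ with respect to $B$, and let $S_B\subseteq S$ be the set of vectors in $S$ whose coordinate indexed by $B$ is $0$. Suppose there exists a quasi-symmetric $2$-$(56,12,9)$ design $\hat{\mathcal{D}}$ with block intersection numbers $0$ and $3$ having $\mathcal{D}_B^*$ as a derived design, i.e. there is a point $z$ of $\hat{\mathcal{D}}$ and a bijection between the $55$ points of $\hat{\mathcal{D}}$ other than $z$ and the $55$ blocks of $\mathcal{D}$ other than $B$ under which the derived design $\hat{\mathcal{D}}^z$ is identified with the dual design $\mathcal{D}_B^*$. Then $S_B$ contains a set of $165$ vectors which (restricted to the $55$ coordinates indexed by the blocks other than $B$) are the incidence vectors of the blocks of a $1$-$(55,12,36)$ design (namely $\hat{\mathcal{D}}_z$) in which every two blocks are either disjoint or share exactly three points.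
   Context: A $t$-$(v,k,\lambda)$ design is a set of $v$ points with a collection of $k$-subsets (blocks) such that every $t$-subset of points lies in exactly $\lambda$ blocks; a $2$-design is symmetric if it has exactly $v$ blocks, and a biplane is a symmetric design with $\lambda=2$. A $2$-design is quasi-symmetric with intersection numbers $x<y$ if every two distinct blocks meet in $x$ or $y$ points. For a block $B$, the residual design $\mathcal{D}_B$ has point set $X\setminus B$ and blocks $B_j\setminus B$ for $B_j\neq B$. For a point $z$ of a design $(X,\mathcal{B})$, the derived design $\hat{\mathcal{D}}^z$ has points $X\setminus\{z\}$ and blocks $B'\setminus\{z\}$ for blocks $B'\ni z$; the residual design $\hat{\mathcal{D}}_z$ has points $X\setminus\{z\}$ and blocks $B'$ with $z\notin B'$. The dual design $\mathcal{D}^*$ interchanges the roles of points and blocks (incidence matrix transposed). Dual codes are with respect to the standard inner product over $GF(3)$. -}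

module Defs where

open import Data.Nat using (ℕ; zero; suc; _+_)
open import Data.Bool using (Bool; true; false; if_then_else_; _∧_; not; T)
open import Data.Fin using (Fin; zero; suc; _≟_)
open import Data.Product using (Σ; _×_; proj₁; ∃)
open import Data.Sum using (_⊎_)
open import Relation.Nullary using (¬_)
open import Relation.Nullary.Decidable using (⌊_⌋)
open import Relation.Binary.PropositionalEquality using (_≡_; _≢_)
open import Function.Bundles using (_↔_; Inverse)

data GF3 : Set where
  𝟘 𝟙 𝟚 : GF3

_⊕_ : GF3 → GF3 → GF3
𝟘 ⊕ y = y
𝟙 ⊕ 𝟘 = 𝟙
𝟙 ⊕ 𝟙 = 𝟚
𝟙 ⊕ 𝟚 = 𝟘
𝟚 ⊕ 𝟘 = 𝟚
𝟚 ⊕ 𝟙 = 𝟘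
𝟚 ⊕ 𝟚 = 𝟙

_⊗_ : GF3 → GF3 → GF3
𝟘 ⊗ y = 𝟘
𝟙 ⊗ y = y
𝟚 ⊗ 𝟘 = 𝟘
𝟚 ⊗ 𝟙 = 𝟚
𝟚 ⊗ 𝟚 = 𝟙

Σ3 : ∀ {n} → (Fin n → GF3) → GF3
Σ3 {zero} f = 𝟘
Σ3 {suc n} f = f zero ⊕ Σ3 (λ i → f (suc i))

_·_ : ∀ {n} → (Fin n → GF3) → (Fin n → GF3) → GF3
x · y = Σ3 (λ i → x i ⊗ y i)

count : ∀ {n} → (Fin n → Bool) → ℕ
count {zero} P = 0
count {suc n} P = (if P zero then 1 else 0) + count (λ i → P (suc i))

_==_ : ∀ {n} → Fin n → Fin n → Bool
i == j = ⌊ i ≟ j ⌋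

nonzero? : GF3 → Bool
nonzero? 𝟘 = false
nonzero? _ = true

isOne? : GF3 → Bool
isOne? 𝟙 = true
isOne? _ = false

bool→GF3 : Bool → GF3
bool→GF3 true = 𝟙
bool→GF3 false = 𝟘

-- A design on v points with b blocks is given by its incidence function
-- Fin v → Fin b → Bool ... here we index blocks first for the general
-- notion (block i, point x).

Is2Design : ∀ {v b} → (Fin b → Fin v → Bool) → ℕ → ℕ → Set
Is2Design {v} {b} Blk k lam =
  (∀ i → count (λ x → Blk i x) ≡ k) ×
  (∀ x y → x ≢ y → count (λ i → Blk i x ∧ Blk i y) ≡ lam)

IsQuasiSymmetric : ∀ {v b} → (Fin b → Fin v → Bool) → ℕ → ℕ → Set
IsQuasiSymmetric {v} {b} Blk a c =
  ∀ i i′ → i ≢ i′ →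
    (count (λ x → Blk i x ∧ Blk i′ x) ≡ a) ⊎ (count (λ x → Blk i x ∧ Blk i′ x) ≡ c)

IsBiplane56 : (Fin 56 → Fin 56 → Bool) → Set
IsBiplane56 D = Is2Design (λ j p → D p j) 11 2

Word : Set
Word = Fin 56 → GF3

row : (Fin 56 → Fin 56 → Bool) → Fin 56 → Word
row D p j = bool→GF3 (D p j)

InL : (Fin 56 → Fin 56 → Bool) → Word → Set
InL D x = Σ (Fin 56 → GF3) λ c → ∀ j → x j ≡ Σ3 (λ p → c p ⊗ row D p j)

InDual : (Fin 56 → Fin 56 → Bool) → Word → Set
InDual D y = ∀ x → InL D x → x · y ≡ 𝟘

Is01 : Word → Set
Is01 y = ∀ j → (y j ≡ 𝟘) ⊎ (y j ≡ 𝟙)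

weight : Word → ℕ
weight y = count (λ j → nonzero? (y j))

InS : (Fin 56 → Fin 56 → Bool) → Word → Set
InS D y = InDual D y × Is01 y × (weight y ≡ 12)

InSB : (Fin 56 → Fin 56 → Bool) → Fin 56 → Word → Set
InSB D B y = InS D y × (y B ≡ 𝟘)

-- Derived design of D̂ at z identified with the dual of the residual D_B.
-- φ : Fin 56 ↔ Fin 56 with φ z ≡ B encodes a bijection between the points
-- of D̂ other than z and the blocks of D other than B.
-- ψ is the bijection between the blocks of the derived design D̂^z
-- (blocks of D̂ through z) and the blocks of D_B^* (points p ∉ B of D);
-- the block of D_B^* indexed by p is { j ≠ B : p ∈ B_j }.
DerivedIsDualResidual :
  ∀ {b} → (D : Fin 56 → Fin 56 → Bool) → (B : Fin 56) →
  (Bhat : Fin b → Fin 56 → Bool) → (z : Fin 56) → (φ : Fin 56 ↔ Fin 56) → Set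
DerivedIsDualResidual {b} D B Bhat z φ =
  (Inverse.to φ z ≡ B) ×
  Σ (Σ (Fin b) (λ i → T (Bhat i z)) ↔ Σ (Fin 56) (λ p → T (not (D p B)))) λ ψ →
    ∀ blk x → x ≢ z →
      Bhat (proj₁ blk) x ≡ D (proj₁ (Inverse.to ψ blk)) (Inverse.to φ x)

blockWord : ∀ {b} → Fin 56 → (Bhat : Fin b → Fin 56 → Bool) →
            (φ : Fin 56 ↔ Fin 56) → Fin b → Word
blockWord B Bhat φ i j =
  if j == B then 𝟘 else bool→GF3 (Bhat i (Inverse.from φ j))

Conclusion : ∀ {b} → (D : Fin 56 → Fin 56 → Bool) → (B : Fin 56) →
  (Bhat : Fin b → Fin 56 → Bool) → (z : Fin 56) → (φ : Fin 56 ↔ Fin 56) → Set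
Conclusion {b} D B Bhat z φ =
  Σ (Fin 165 → Word) λ vs →
    (∀ k → InSB D B (vs k)) ×
    (∀ k l → k ≢ l → ∃ λ j → vs k j ≢ vs l j) ×
    (Σ (Fin 165 ↔ Σ (Fin b) (λ i → T (not (Bhat i z)))) λ θ →
       ∀ k j → vs k j ≡ blockWord B Bhat φ (proj₁ (Inverse.to θ k)) j) ×
    (∀ k → count (λ j → not (j == B) ∧ isOne? (vs k j)) ≡ 12) ×
    (∀ j → j ≢ B → count (λ k → isOne? (vs k j)) ≡ 36) ×
    (∀ k l → k ≢ l →
       (count (λ j → not (j == B) ∧ isOne? (vs k j) ∧ isOne? (vs l j)) ≡ 0) ⊎
       (count (λ j → not (j == B) ∧ isOne? (vs k j) ∧ isOne? (vs l j)) ≡ 3))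

-- Write N(p) for the number of blocks of D through the point p that lie in the support of a
-- (0,1)-vector y, so that y ∈ L^⊥ exactly when 3 ∣ N(p) for every p.  Take y to be a block of
-- D̂ avoiding z, carried to the blocks of D by φ.  A point p ∉ B is, via the derived design, a
-- block i′ ∋ z of D̂, and N(p) = |y ∩ i′| ∈ {0, 3}.  For the points of B we use that any two
-- blocks of a symmetric design meet in λ points (the first two moments of the intersection
-- numbers leave no variance), here in 2 ≡ 11 (mod 3) points, so for every block B_j
-- Σ_{p ∈ B_j} N(p) = Σ_{j′ ∈ y} |B_j ∩ B_j′| ≡ 2 |y| = 24 ≡ 0.  For two points u, w of B the
-- second block through them meets B only in {u, w}, which gives N(u) + N(w) ≡ 0; three points
-- of B then force N(p) ≡ 0 in characteristic 3.  The remaining properties are counting: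
-- D̂ has 210 blocks and replication 45, so 165 blocks avoid z and each other point lies in
-- 45 − 9 = 36 of them.

module Submission where

open import Defs
open import Data.Nat using (ℕ)
open import Data.Bool using (Bool)
open import Data.Fin using (Fin)
open import Function.Bundles using (_↔_)

open import Algebra.Bundles using (CommutativeMonoid; CommutativeSemiring)
open import Algebra.Structures.Biased using (isCommutativeMonoidʳ; isCommutativeSemiringˡ)
import Algebra.Properties.CommutativeMonoid.Sum as CommutativeMonoidSum
import Algebra.Properties.Semiring.Sum as SemiringSum
open import Data.Bool using (true; false; if_then_else_; _∧_; not; T)
open import Data.Bool.Properties using (∧-idem; ∧-identityʳ; ∧-zeroʳ; ¬-not; ∧-assoc; T-irrelevant; T-not-≡)
  renaming (_≟_ to _≟ᵇ_)
open import Data.Empty using (⊥-elim)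
open import Data.Fin using (zero; suc; punchIn; punchOut; _≟_)
open import Data.Fin.Properties using (punchInᵢ≢i; punchIn-injective; punchIn-punchOut; ¬∀⟶∃¬)
open import Data.Nat using (zero; suc; _+_; _*_; _≤_; _<_; z≤n; s≤s; s≤s⁻¹)
import Data.Nat.Properties as ℕ
open import Data.Nat.Tactic.RingSolver using (solve-∀)
open import Data.Product using (Σ; _×_; _,_; proj₁; proj₂; ∃; ∃₂; map)
open import Data.Sum using (_⊎_; inj₁; inj₂; [_,_]′; reduce)
open import Data.Unit using (tt)
open import Data.Vec.Functional using (removeAt)
open import Function.Base using (_∘_; id)
open import Function.Bundles using (Equivalence; Inverse; mk↔ₛ′)
open import Function.Properties.Inverse using (↔-sym; ↔-trans)
open import Relation.Binary.PropositionalEquality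
  using (_≡_; _≢_; refl; sym; trans; cong; cong₂; subst; module ≡-Reasoning)
open import Relation.Binary.PropositionalEquality.Algebra using (isMagma)
open import Relation.Nullary using (¬_; yes; no)
open import Relation.Nullary.Decidable using (dec-true; dec-false; isYes≗does; ⌊⌋-map′; toWitness)

-- GF(3)

⊕-assoc : ∀ a b c → (a ⊕ b) ⊕ c ≡ a ⊕ (b ⊕ c)
⊕-assoc 𝟘 b c = refl
⊕-assoc 𝟙 𝟘 c = refl
⊕-assoc 𝟙 𝟙 𝟘 = refl
⊕-assoc 𝟙 𝟙 𝟙 = refl
⊕-assoc 𝟙 𝟙 𝟚 = refl
⊕-assoc 𝟙 𝟚 𝟘 = refl
⊕-assoc 𝟙 𝟚 𝟙 = refl
⊕-assoc 𝟙 𝟚 𝟚 = refl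
⊕-assoc 𝟚 𝟘 c = refl
⊕-assoc 𝟚 𝟙 𝟘 = refl
⊕-assoc 𝟚 𝟙 𝟙 = refl
⊕-assoc 𝟚 𝟙 𝟚 = refl
⊕-assoc 𝟚 𝟚 𝟘 = refl
⊕-assoc 𝟚 𝟚 𝟙 = refl
⊕-assoc 𝟚 𝟚 𝟚 = refl

⊕-comm : ∀ a b → a ⊕ b ≡ b ⊕ a
⊕-comm 𝟘 𝟘 = refl
⊕-comm 𝟘 𝟙 = refl
⊕-comm 𝟘 𝟚 = refl
⊕-comm 𝟙 𝟘 = refl
⊕-comm 𝟙 𝟙 = refl
⊕-comm 𝟙 𝟚 = refl
⊕-comm 𝟚 𝟘 = refl
⊕-comm 𝟚 𝟙 = refl
⊕-comm 𝟚 𝟚 = refl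

⊕-identityʳ : ∀ a → a ⊕ 𝟘 ≡ a
⊕-identityʳ 𝟘 = refl
⊕-identityʳ 𝟙 = refl
⊕-identityʳ 𝟚 = refl

⊗-assoc : ∀ a b c → (a ⊗ b) ⊗ c ≡ a ⊗ (b ⊗ c)
⊗-assoc 𝟘 b c = refl
⊗-assoc 𝟙 b c = refl
⊗-assoc 𝟚 𝟘 c = refl
⊗-assoc 𝟚 𝟙 c = refl
⊗-assoc 𝟚 𝟚 𝟘 = refl
⊗-assoc 𝟚 𝟚 𝟙 = refl
⊗-assoc 𝟚 𝟚 𝟚 = refl

⊗-comm : ∀ a b → a ⊗ b ≡ b ⊗ a
⊗-comm 𝟘 𝟘 = refl
⊗-comm 𝟘 𝟙 = refl
⊗-comm 𝟘 𝟚 = refl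
⊗-comm 𝟙 𝟘 = refl
⊗-comm 𝟙 𝟙 = refl
⊗-comm 𝟙 𝟚 = refl
⊗-comm 𝟚 𝟘 = refl
⊗-comm 𝟚 𝟙 = refl
⊗-comm 𝟚 𝟚 = refl

⊗-identityʳ : ∀ a → a ⊗ 𝟙 ≡ a
⊗-identityʳ 𝟘 = refl
⊗-identityʳ 𝟙 = refl
⊗-identityʳ 𝟚 = refl

⊗-distribʳ-⊕ : ∀ a b c → (b ⊕ c) ⊗ a ≡ (b ⊗ a) ⊕ (c ⊗ a)
⊗-distribʳ-⊕ a 𝟘 c = refl
⊗-distribʳ-⊕ a 𝟙 𝟘 = sym (⊕-identityʳ a)
⊗-distribʳ-⊕ a 𝟚 𝟘 = sym (⊕-identityʳ (𝟚 ⊗ a))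
⊗-distribʳ-⊕ 𝟘 𝟙 𝟙 = refl
⊗-distribʳ-⊕ 𝟙 𝟙 𝟙 = refl
⊗-distribʳ-⊕ 𝟚 𝟙 𝟙 = refl
⊗-distribʳ-⊕ 𝟘 𝟙 𝟚 = refl
⊗-distribʳ-⊕ 𝟙 𝟙 𝟚 = refl
⊗-distribʳ-⊕ 𝟚 𝟙 𝟚 = refl
⊗-distribʳ-⊕ 𝟘 𝟚 𝟙 = refl
⊗-distribʳ-⊕ 𝟙 𝟚 𝟙 = refl
⊗-distribʳ-⊕ 𝟚 𝟚 𝟙 = refl
⊗-distribʳ-⊕ 𝟘 𝟚 𝟚 = refl
⊗-distribʳ-⊕ 𝟙 𝟚 𝟚 = refl
⊗-distribʳ-⊕ 𝟚 𝟚 𝟚 = refl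

GF3-commutativeSemiring : CommutativeSemiring _ _
GF3-commutativeSemiring = record
  { isCommutativeSemiring = isCommutativeSemiringˡ record
    { +-isCommutativeMonoid = isCommutativeMonoidʳ record
      { isSemigroup = record { isMagma = isMagma _⊕_ ; assoc = ⊕-assoc }
      ; identityʳ = ⊕-identityʳ
      ; comm = ⊕-comm
      }
    ; *-isCommutativeMonoid = isCommutativeMonoidʳ record
      { isSemigroup = record { isMagma = isMagma _⊗_ ; assoc = ⊗-assoc }
      ; identityʳ = ⊗-identityʳ
      ; comm = ⊗-comm
      }
    ; distribʳ = ⊗-distribʳ-⊕
    ; zeroˡ = λ _ → refl
    }
  }

module Σ₃ = SemiringSum (CommutativeSemiring.semiring GF3-commutativeSemiring)
open SemiringSum ℕ.+-*-semiring
  using (sum; ∑-comm; ∑-distrib-+; sum-remove; sum-permute; sum-cong-≗; *-distribˡ-sum; *-distribʳ-sum)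

Σ3≡sum : ∀ {n} (f : Fin n → GF3) → Σ3 f ≡ Σ₃.sum f
Σ3≡sum {zero} f = refl
Σ3≡sum {suc n} f = cong (f zero ⊕_) (Σ3≡sum (f ∘ suc))

pairwise-sums≡𝟘⇒≡𝟘 : ∀ x y z → x ⊕ y ≡ 𝟘 → x ⊕ z ≡ 𝟘 → y ⊕ z ≡ 𝟘 → x ≡ 𝟘
pairwise-sums≡𝟘⇒≡𝟘 𝟘 _ _ _ _ _ = refl
pairwise-sums≡𝟘⇒≡𝟘 𝟙 𝟚 𝟚 _ _ ()
pairwise-sums≡𝟘⇒≡𝟘 𝟚 𝟙 𝟙 _ _ ()

ℕ→GF3 : ℕ → GF3
ℕ→GF3 zero = 𝟘
ℕ→GF3 (suc n) = 𝟙 ⊕ ℕ→GF3 n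

ℕ→GF3-+ : ∀ m n → ℕ→GF3 (m + n) ≡ ℕ→GF3 m ⊕ ℕ→GF3 n
ℕ→GF3-+ zero n = refl
ℕ→GF3-+ (suc m) n = trans (cong (𝟙 ⊕_) (ℕ→GF3-+ m n)) (sym (⊕-assoc 𝟙 (ℕ→GF3 m) (ℕ→GF3 n)))

ℕ→GF3-* : ∀ m n → ℕ→GF3 (m * n) ≡ ℕ→GF3 m ⊗ ℕ→GF3 n
ℕ→GF3-* zero n = refl
ℕ→GF3-* (suc m) n = begin
  ℕ→GF3 (n + m * n)                 ≡⟨ ℕ→GF3-+ n (m * n) ⟩
  ℕ→GF3 n ⊕ ℕ→GF3 (m * n)           ≡⟨ cong (ℕ→GF3 n ⊕_) (ℕ→GF3-* m n) ⟩
  ℕ→GF3 n ⊕ (ℕ→GF3 m ⊗ ℕ→GF3 n)     ≡⟨ ⊗-distribʳ-⊕ (ℕ→GF3 n) 𝟙 (ℕ→GF3 m) ⟨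
  (𝟙 ⊕ ℕ→GF3 m) ⊗ ℕ→GF3 n           ∎
  where open ≡-Reasoning

ℕ→GF3-sum : ∀ {n} (f : Fin n → ℕ) → ℕ→GF3 (sum f) ≡ Σ₃.sum (ℕ→GF3 ∘ f)
ℕ→GF3-sum {zero} f = refl
ℕ→GF3-sum {suc n} f =
  trans (ℕ→GF3-+ (f zero) (sum (f ∘ suc))) (cong (ℕ→GF3 (f zero) ⊕_) (ℕ→GF3-sum (f ∘ suc)))

-- Counting

χ : Bool → ℕ
χ b = if b then 1 else 0

χ-∧ : ∀ a b → χ (a ∧ b) ≡ χ a * χ b
χ-∧ true b = sym (ℕ.+-identityʳ (χ b))
χ-∧ false b = refl

ℕ→GF3-χ* : ∀ a n → (a ≡ true → ℕ→GF3 n ≡ 𝟘) → ℕ→GF3 (χ a * n) ≡ 𝟘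
ℕ→GF3-χ* true n a→𝟘 = trans (cong ℕ→GF3 (ℕ.+-identityʳ n)) (a→𝟘 refl)
ℕ→GF3-χ* false n a→𝟘 = refl

count≡sum : ∀ {n} (P : Fin n → Bool) → count P ≡ sum (χ ∘ P)
count≡sum {zero} P = refl
count≡sum {suc n} P = cong (χ (P zero) +_) (count≡sum (P ∘ suc))

count-cong : ∀ {n} {P Q : Fin n → Bool} → (∀ i → P i ≡ Q i) → count P ≡ count Q
count-cong {zero} P≗Q = refl
count-cong {suc n} P≗Q = cong₂ (λ b c → χ b + c) (P≗Q zero) (count-cong (P≗Q ∘ suc))

count-∧ : ∀ {n} (P Q : Fin n → Bool) → count (λ i → P i ∧ Q i) ≡ sum (λ i → χ (P i) * χ (Q i))
count-∧ P Q = trans (count≡sum (λ i → P i ∧ Q i)) (sum-cong-≗ (λ i → χ-∧ (P i) (Q i)))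

count-true : ∀ n → count {n} (λ _ → true) ≡ n
count-true zero = refl
count-true (suc n) = cong suc (count-true n)

count-permute : ∀ {m n} (π : Fin m ↔ Fin n) (P : Fin n → Bool) →
  count (P ∘ Inverse.to π) ≡ count P
count-permute π P =
  trans (count≡sum (P ∘ Inverse.to π)) (trans (sym (sum-permute (χ ∘ P) π)) (sym (count≡sum P)))

count-split : ∀ {n} (P Q : Fin n → Bool) →
  count (λ i → not (P i) ∧ Q i) + count (λ i → P i ∧ Q i) ≡ count Q
count-split P Q = begin
  count (λ i → not (P i) ∧ Q i) + count (λ i → P i ∧ Q i)
    ≡⟨ cong₂ _+_ (count≡sum (λ i → not (P i) ∧ Q i)) (count≡sum (λ i → P i ∧ Q i)) ⟩
  sum (λ i → χ (not (P i) ∧ Q i)) + sum (λ i → χ (P i ∧ Q i))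
    ≡⟨ ∑-distrib-+ (λ i → χ (not (P i) ∧ Q i)) (λ i → χ (P i ∧ Q i)) ⟨
  sum (λ i → χ (not (P i) ∧ Q i) + χ (P i ∧ Q i))
    ≡⟨ sum-cong-≗ (λ i → split (P i) (Q i)) ⟩
  sum (χ ∘ Q)
    ≡⟨ count≡sum Q ⟨
  count Q ∎
  where
  open ≡-Reasoning
  split : ∀ a b → χ (not a ∧ b) + χ (a ∧ b) ≡ χ b
  split true b = refl
  split false b = ℕ.+-identityʳ (χ b)

count-complement : ∀ {n} (P : Fin n → Bool) → count (not ∘ P) + count P ≡ n
count-complement {n} P = begin
  count (not ∘ P) + count P
    ≡⟨ cong₂ _+_ (count-cong (λ i → sym (∧-identityʳ (not (P i)))))
                 (count-cong (λ i → sym (∧-identityʳ (P i)))) ⟩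
  count (λ i → not (P i) ∧ true) + count (λ i → P i ∧ true)
    ≡⟨ count-split P (λ _ → true) ⟩
  count {n} (λ _ → true)
    ≡⟨ count-true n ⟩
  n ∎
  where open ≡-Reasoning

count-remove : ∀ {n} (P : Fin (suc n) → Bool) {a} → P a ≡ true → count P ≡ suc (count (removeAt P a))
count-remove P {a} Pa = begin
  count P                            ≡⟨ count≡sum P ⟩
  sum (χ ∘ P)                        ≡⟨ sum-remove (χ ∘ P) ⟩
  χ (P a) + sum (removeAt (χ ∘ P) a) ≡⟨ cong₂ _+_ (cong χ Pa) (sym (count≡sum (removeAt P a))) ⟩
  suc (count (removeAt P a))         ∎
  where open ≡-Reasoning

count-member : ∀ {n} (P : Fin n → Bool) → 1 ≤ count P → ∃ λ i → P i ≡ true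
count-member {suc n} P 1≤count with P zero in P₀
... | true = zero , P₀
... | false = map suc id (count-member (P ∘ suc) 1≤count)

==-true : ∀ {n} {i j : Fin n} → i ≡ j → (i == j) ≡ true
==-true {i = i} {j} i≡j = trans (isYes≗does (i ≟ j)) (dec-true (i ≟ j) i≡j)

==-false : ∀ {n} {i j : Fin n} → i ≢ j → (i == j) ≡ false
==-false {i = i} {j} i≢j = trans (isYes≗does (i ≟ j)) (dec-false (i ≟ j) i≢j)

==⇒≡ : ∀ {n} {i j : Fin n} → (i == j) ≡ true → i ≡ j
==⇒≡ {i = i} {j} i==j = toWitness (subst T (sym i==j) tt)

==-false⁻ : ∀ {n} {i j : Fin n} → (i == j) ≡ false → i ≢ j
==-false⁻ i==j i≡j = subst T (trans (sym (==-true i≡j)) i==j) tt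

∧≡true : ∀ {x y} → x ∧ y ≡ true → x ≡ true × y ≡ true
∧≡true {true} {true} _ = refl , refl

not∧≡true : ∀ {x y} → not x ∧ y ≡ true → x ≡ false × y ≡ true
not∧≡true {false} {true} _ = refl , refl

_∖_ : ∀ {n} → (Fin n → Bool) → Fin n → Fin n → Bool
(P ∖ a) i = not (i == a) ∧ P i

count-∖ : ∀ {n} (P : Fin n → Bool) {a} → P a ≡ true → count P ≡ suc (count (P ∖ a))
count-∖ {suc n} P {zero} P₀ rewrite P₀ = refl
count-∖ {suc n} P {suc a} Pa = begin
  χ (P zero) + count (P ∘ suc)                ≡⟨ cong (χ (P zero) +_) (count-∖ (P ∘ suc) Pa) ⟩
  χ (P zero) + suc (count ((P ∘ suc) ∖ a))    ≡⟨ ℕ.+-suc (χ (P zero)) _ ⟩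
  suc (χ (P zero) + count ((P ∘ suc) ∖ a))    ≡⟨ cong (λ c → suc (χ (P zero) + c)) (count-cong suc==suc) ⟩
  suc (count (P ∖ suc a))                     ∎
  where
  open ≡-Reasoning
  suc==suc : ∀ i → ((P ∘ suc) ∖ a) i ≡ (P ∖ suc a) (suc i)
  suc==suc i = cong (λ b → not b ∧ P (suc i)) (sym (⌊⌋-map′ _ _ (i ≟ a)))

∖-member : ∀ {n} (P : Fin n → Bool) {a i} → i ≢ a → P i ≡ true → (P ∖ a) i ≡ true
∖-member P i≢a Pi rewrite ==-false i≢a = Pi

∖-member⁻ : ∀ {n} (P : Fin n → Bool) {a i} → (P ∖ a) i ≡ true → i ≢ a × P i ≡ true
∖-member⁻ P P∖a-i = let i==a , Pi = not∧≡true P∖a-i in ==-false⁻ i==a , Pi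

≤-count-∖ : ∀ {n} (P : Fin n → Bool) {a k} → P a ≡ true → suc k ≤ count P → k ≤ count (P ∖ a)
≤-count-∖ P {k = k} Pa = s≤s⁻¹ ∘ subst (suc k ≤_) (count-∖ P Pa)

two-more-members : ∀ {n} (P : Fin n → Bool) {p} → 3 ≤ count P → P p ≡ true →
  ∃₂ λ u w → P u ≡ true × P w ≡ true × u ≢ p × w ≢ p × w ≢ u
two-more-members P {p} 3≤count Pp =
  let 2≤count∖p = ≤-count-∖ P Pp 3≤count
      u , P∖p-u = count-member (P ∖ p) (ℕ.<⇒≤ 2≤count∖p)
      w , P∖p∖u-w = count-member ((P ∖ p) ∖ u) (≤-count-∖ (P ∖ p) P∖p-u 2≤count∖p)
      u≢p , Pu = ∖-member⁻ P P∖p-u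
      w≢u , P∖p-w = ∖-member⁻ (P ∖ p) P∖p∖u-w
      w≢p , Pw = ∖-member⁻ P P∖p-w
  in u , w , Pu , Pw , u≢p , w≢p , w≢u

count≡2-member⇒≡⊎≡ : ∀ {n} (P : Fin n → Bool) {u w p} → count P ≡ 2 → u ≢ w →
  P u ≡ true → P w ≡ true → P p ≡ true → p ≡ u ⊎ p ≡ w
count≡2-member⇒≡⊎≡ P {u} {w} {p} count≡2 u≢w Pu Pw Pp with p ≟ u | p ≟ w
... | yes p≡u | _ = inj₁ p≡u
... | no _ | yes p≡w = inj₂ p≡w
... | no p≢u | no p≢w = ⊥-elim (ℕ.0≢1+n (trans (sym count∖∖≡0)
      (count-∖ ((P ∖ u) ∖ w) {p} (∖-member (P ∖ u) p≢w (∖-member P p≢u Pp)))))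
  where
  count∖∖≡0 : count ((P ∖ u) ∖ w) ≡ 0
  count∖∖≡0 = ℕ.suc-injective (ℕ.suc-injective (begin
    suc (suc (count ((P ∖ u) ∖ w))) ≡⟨ cong suc (count-∖ (P ∖ u) (∖-member P (u≢w ∘ sym) Pw)) ⟨
    suc (count (P ∖ u))             ≡⟨ count-∖ P Pu ⟨
    count P                         ≡⟨ count≡2 ⟩
    2                               ∎))
    where open ≡-Reasoning

Members : ∀ {n} → (Fin n → Bool) → Set
Members {n} P = Σ (Fin n) (λ i → T (P i))

members-≡ : ∀ {n} {P : Fin n → Bool} {s t : Members P} → proj₁ s ≡ proj₁ t → s ≡ t
members-≡ {s = i , p} {.i , q} refl = cong (i ,_) (T-irrelevant p q)

private
  module Extend {n} (P : Fin (suc n) → Bool) (E : Fin (count (P ∘ suc)) ↔ Members (P ∘ suc)) where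
    open Inverse E

    extend : ∀ b → P zero ≡ b → Fin (χ b + count (P ∘ suc)) ↔ Members P
    extend true P₀ = mk↔ₛ′ to′ from′ to∘from from∘to
      where
      to′ : Fin (suc (count (P ∘ suc))) → Members P
      to′ zero = zero , subst T (sym P₀) tt
      to′ (suc k) = suc (proj₁ (to k)) , proj₂ (to k)
      from′ : Members P → Fin (suc (count (P ∘ suc)))
      from′ (zero , _) = zero
      from′ (suc i , Pi) = suc (from (i , Pi))
      to∘from : ∀ s → to′ (from′ s) ≡ s
      to∘from (zero , _) = members-≡ refl
      to∘from (suc i , Pi) = cong (λ s → suc (proj₁ s) , proj₂ s) (strictlyInverseˡ (i , Pi))
      from∘to : ∀ k → from′ (to′ k) ≡ k
      from∘to zero = refl
      from∘to (suc k) = cong suc (strictlyInverseʳ k)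
    extend false P₀ = mk↔ₛ′ to′ from′ to∘from strictlyInverseʳ
      where
      to′ : Fin (count (P ∘ suc)) → Members P
      to′ k = suc (proj₁ (to k)) , proj₂ (to k)
      from′ : Members P → Fin (count (P ∘ suc))
      from′ (zero , P₀-true) = ⊥-elim (subst T P₀ P₀-true)
      from′ (suc i , Pi) = from (i , Pi)
      to∘from : ∀ s → to′ (from′ s) ≡ s
      to∘from (zero , P₀-true) = ⊥-elim (subst T P₀ P₀-true)
      to∘from (suc i , Pi) = cong (λ s → suc (proj₁ s) , proj₂ s) (strictlyInverseˡ (i , Pi))

    count-extend : ∀ b (P₀ : P zero ≡ b) →
      (∀ Q → count (Q ∘ proj₁ ∘ to) ≡ count (λ i → P (suc i) ∧ Q i)) →
      ∀ Q → count (Q ∘ proj₁ ∘ Inverse.to (extend b P₀)) ≡ count (λ i → P i ∧ Q i)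
    count-extend true P₀ count-to Q rewrite P₀ = cong (χ (Q zero) +_) (count-to (Q ∘ suc))
    count-extend false P₀ count-to Q rewrite P₀ = count-to (Q ∘ suc)

enumerate : ∀ {n} (P : Fin n → Bool) → Fin (count P) ↔ Members P
enumerate {zero} P = mk↔ₛ′ (λ ()) (λ ()) (λ ()) (λ ())
enumerate {suc n} P = Extend.extend P (enumerate (P ∘ suc)) (P zero) refl

count-enumerate : ∀ {n} (P Q : Fin n → Bool) →
  count (Q ∘ proj₁ ∘ Inverse.to (enumerate P)) ≡ count (λ i → P i ∧ Q i)
count-enumerate {zero} P Q = refl
count-enumerate {suc n} P =
  Extend.count-extend P (enumerate (P ∘ suc)) (P zero) refl (count-enumerate (P ∘ suc))

count-reindex : ∀ {m n} (P : Fin n → Bool) (θ : Fin m ↔ Members P) (Q : Fin n → Bool) →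
  count (Q ∘ proj₁ ∘ Inverse.to θ) ≡ count (λ i → P i ∧ Q i)
count-reindex P θ Q = begin
  count (Q ∘ proj₁ ∘ Inverse.to θ)
    ≡⟨ count-cong (λ k → cong (Q ∘ proj₁) (sym (Inverse.strictlyInverseˡ E (Inverse.to θ k)))) ⟩
  count (Q ∘ proj₁ ∘ Inverse.to E ∘ Inverse.to π)
    ≡⟨ count-permute π (Q ∘ proj₁ ∘ Inverse.to E) ⟩
  count (Q ∘ proj₁ ∘ Inverse.to E)
    ≡⟨ count-enumerate P Q ⟩
  count (λ i → P i ∧ Q i) ∎
  where
  open ≡-Reasoning
  E : Fin (count P) ↔ Members P
  E = enumerate P
  π : Fin _ ↔ Fin (count P)
  π = ↔-trans θ (↔-sym E)

-- Sums and moments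

sum-const : ∀ n c → sum {n} (λ _ → c) ≡ n * c
sum-const zero c = refl
sum-const (suc n) c = cong (c +_) (sum-const n c)

sum-mono-≤ : ∀ {n} {f g : Fin n → ℕ} → (∀ i → f i ≤ g i) → sum f ≤ sum g
sum-mono-≤ {zero} f≤g = z≤n
sum-mono-≤ {suc n} f≤g = ℕ.+-mono-≤ (f≤g zero) (sum-mono-≤ (f≤g ∘ suc))

sum-≤-tight : ∀ {n} (f g : Fin n → ℕ) → (∀ i → g i ≤ f i) → sum f ≡ sum g → ∀ i → f i ≡ g i
sum-≤-tight {suc n} f g g≤f sum≡ =
  λ { zero → f₀≡g₀ ; (suc i) → sum-≤-tight (f ∘ suc) (g ∘ suc) (g≤f ∘ suc) rest≡ i }
  where
  f₀≤g₀ : f zero ≤ g zero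
  f₀≤g₀ = ℕ.+-cancelʳ-≤ (sum (g ∘ suc)) (f zero) (g zero)
    (ℕ.≤-trans (ℕ.+-monoʳ-≤ (f zero) (sum-mono-≤ (g≤f ∘ suc))) (ℕ.≤-reflexive sum≡))
  f₀≡g₀ : f zero ≡ g zero
  f₀≡g₀ = ℕ.≤-antisym f₀≤g₀ (g≤f zero)
  rest≡ : sum (f ∘ suc) ≡ sum (g ∘ suc)
  rest≡ = ℕ.+-cancelˡ-≡ (f zero) _ _ (trans sum≡ (cong (_+ sum (g ∘ suc)) (sym f₀≡g₀)))

*-suc-cancel : ∀ r n c → r * suc n ≡ r + c → r * n ≡ c
*-suc-cancel r n c r*[1+n]≡r+c = ℕ.+-cancelˡ-≡ r (r * n) c (trans (sym (ℕ.*-suc r n)) r*[1+n]≡r+c)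

same-solution : ∀ {k c} r s → 1 < k → r * k ≡ r + c → s * k ≡ s + c → r ≡ s
same-solution {suc (suc k)} {c} r s (s≤s (s≤s z≤n)) rk≡r+c sk≡s+c =
  ℕ.*-cancelʳ-≡ r s (suc k) (trans (*-suc-cancel r (suc k) c rk≡r+c) (sym (*-suc-cancel s (suc k) c sk≡s+c)))

square-gap : ∀ x c → ∃ λ d → (x * x + c * c ≡ 2 * c * x + d * d) × (d ≡ 0 → x ≡ c)
square-gap x c with ℕ.≤-total x c
... | inj₁ x≤c with ℕ.m≤n⇒∃[o]m+o≡n x≤c
...   | d , refl = d , gap x d , λ { refl → sym (ℕ.+-identityʳ x) }
  where
  gap : ∀ x d → x * x + (x + d) * (x + d) ≡ 2 * (x + d) * x + d * d
  gap = solve-∀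
square-gap x c | inj₂ c≤x with ℕ.m≤n⇒∃[o]m+o≡n c≤x
...   | d , refl = d , gap c d , λ { refl → ℕ.+-identityʳ c }
  where
  gap : ∀ c d → (c + d) * (c + d) + c * c ≡ 2 * c * (c + d) + d * d
  gap = solve-∀

2cx≤x²+c² : ∀ x c → 2 * c * x ≤ x * x + c * c
2cx≤x²+c² x c with square-gap x c
... | d , gap , _ = subst (2 * c * x ≤_) (sym gap) (ℕ.m≤m+n (2 * c * x) (d * d))

2cx≡x²+c²⇒x≡c : ∀ x c → x * x + c * c ≡ 2 * c * x → x ≡ c
2cx≡x²+c²⇒x≡c x c x²+c²≡2cx with square-gap x c
... | d , gap , d≡0⇒x≡c = d≡0⇒x≡c (reduce (ℕ.m*n≡0⇒m≡0∨n≡0 d (ℕ.+-cancelˡ-≡ (2 * c * x) _ 0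
      (trans (sym gap) (trans x²+c²≡2cx (sym (ℕ.+-identityʳ _)))))))

constant-from-moments : ∀ {m} (x : Fin m → ℕ) c →
  sum x ≡ m * c → sum (λ i → x i * x i) ≡ m * (c * c) → ∀ i → x i ≡ c
constant-from-moments {m} x c sum-x sum-x² i =
  2cx≡x²+c²⇒x≡c (x i) c (sum-≤-tight f g (λ i → 2cx≤x²+c² (x i) c) sum-f≡sum-g i)
  where
  open ≡-Reasoning
  f g : Fin m → ℕ
  f i = x i * x i + c * c
  g i = 2 * c * x i
  sum-f≡sum-g : sum f ≡ sum g
  sum-f≡sum-g = begin
    sum f                                   ≡⟨ ∑-distrib-+ (λ i → x i * x i) (λ _ → c * c) ⟩
    sum (λ i → x i * x i) + sum {m} (λ _ → c * c) ≡⟨ cong₂ _+_ sum-x² (sum-const m (c * c)) ⟩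
    m * (c * c) + m * (c * c)               ≡⟨ identity m c ⟩
    2 * c * (m * c)                         ≡⟨ cong (2 * c *_) sum-x ⟨
    2 * c * sum x                           ≡⟨ *-distribˡ-sum (2 * c) x ⟩
    sum g                                   ∎
    where
    identity : ∀ m c → m * (c * c) + m * (c * c) ≡ 2 * c * (m * c)
    identity = solve-∀

module _ {c ℓ} (M : CommutativeMonoid c ℓ) where
  open CommutativeMonoid M using (Carrier; _≈_; _∙_; ε; ∙-congˡ; identityʳ; setoid)
    renaming (trans to ≈-trans)
  private module Σᴹ = CommutativeMonoidSum M
  open import Relation.Binary.Reasoning.Setoid setoid

  sum-supported-on-pair : ∀ {n} (t : Fin n → Carrier) {u w} → u ≢ w →
    (∀ p → p ≢ u → p ≢ w → t p ≈ ε) → Σᴹ.sum t ≈ t u ∙ t w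
  sum-supported-on-pair {suc zero} t {zero} {zero} u≢w _ = ⊥-elim (u≢w refl)
  sum-supported-on-pair {suc (suc n)} t {u} {w} u≢w vanishes = begin
    Σᴹ.sum t                               ≈⟨ Σᴹ.sum-remove t ⟩
    t u ∙ Σᴹ.sum (removeAt t u)            ≈⟨ ∙-congˡ (Σᴹ.sum-remove (removeAt t u)) ⟩
    t u ∙ (removeAt t u w′ ∙ Σᴹ.sum rest)  ≡⟨ cong (λ a → t u ∙ (a ∙ Σᴹ.sum rest)) (cong t (punchIn-punchOut u≢w)) ⟩
    t u ∙ (t w ∙ Σᴹ.sum rest)              ≈⟨ ∙-congˡ (∙-congˡ rest≈ε) ⟩
    t u ∙ (t w ∙ ε)                        ≈⟨ ∙-congˡ (identityʳ (t w)) ⟩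
    t u ∙ t w                              ∎
    where
    w′ : Fin (suc n)
    w′ = punchOut u≢w
    rest : Fin n → Carrier
    rest = removeAt (removeAt t u) w′
    rest≈ε : Σᴹ.sum rest ≈ ε
    rest≈ε = ≈-trans (Σᴹ.sum-cong-≋ (λ i → vanishes _ (punchInᵢ≢i u _) (λ ≡w → punchInᵢ≢i w′ i
               (punchIn-injective u _ _ (trans ≡w (sym (punchIn-punchOut u≢w)))))))
             (Σᴹ.sum-replicate-zero n)

-- Designs

double-count : ∀ {b v} (Inc : Fin b → Fin v → Bool) →
  sum (λ i → count (Inc i)) ≡ sum (λ x → count (λ i → Inc i x))
double-count Inc = begin
  sum (λ i → count (Inc i))             ≡⟨ sum-cong-≗ (λ i → count≡sum (Inc i)) ⟩
  sum (λ i → sum (λ x → χ (Inc i x)))   ≡⟨ ∑-comm (λ i x → χ (Inc i x)) ⟩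
  sum (λ x → sum (λ i → χ (Inc i x)))   ≡⟨ sum-cong-≗ (λ x → count≡sum (λ i → Inc i x)) ⟨
  sum (λ x → count (λ i → Inc i x))     ∎
  where open ≡-Reasoning

module TwoDesign {m b} (Blk : Fin b → Fin (suc m) → Bool) {k lam} (design : Is2Design Blk k lam) where

  r : Fin (suc m) → ℕ
  r x = count (λ i → Blk i x)

  block-count : b * k ≡ sum r
  block-count = trans (sym (trans (sum-cong-≗ (proj₁ design)) (sum-const b k))) (double-count Blk)

  replication : ∀ x → r x * k ≡ r x + m * lam
  replication x = begin
    r x * k
      ≡⟨ cong (_* k) (count≡sum (λ i → Blk i x)) ⟩
    sum (λ i → χ (Blk i x)) * k
      ≡⟨ *-distribʳ-sum k (λ i → χ (Blk i x)) ⟩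
    sum (λ i → χ (Blk i x) * k)
      ≡⟨ sum-cong-≗ (λ i → cong (χ (Blk i x) *_) (trans (sym (proj₁ design i)) (count≡sum (Blk i)))) ⟩
    sum (λ i → χ (Blk i x) * sum (λ y → χ (Blk i y)))
      ≡⟨ sum-cong-≗ (λ i → *-distribˡ-sum (χ (Blk i x)) (λ y → χ (Blk i y))) ⟩
    sum (λ i → sum (λ y → χ (Blk i x) * χ (Blk i y)))
      ≡⟨ ∑-comm (λ i y → χ (Blk i x) * χ (Blk i y)) ⟩
    sum (λ y → sum (λ i → χ (Blk i x) * χ (Blk i y)))
      ≡⟨ sum-cong-≗ (λ y → count-∧ (λ i → Blk i x) (λ i → Blk i y)) ⟨
    sum (λ y → count (λ i → Blk i x ∧ Blk i y))
      ≡⟨ sum-remove (λ y → count (λ i → Blk i x ∧ Blk i y)) ⟩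
    count (λ i → Blk i x ∧ Blk i x) + sum (λ y → count (λ i → Blk i x ∧ Blk i (punchIn x y)))
      ≡⟨ cong₂ _+_ (count-cong (λ i → ∧-idem (Blk i x)))
                   (sum-cong-≗ (λ y → proj₂ design x (punchIn x y) (punchInᵢ≢i x y ∘ sym))) ⟩
    r x + sum {m} (λ _ → lam)
      ≡⟨ cong (r x +_) (sum-const m lam) ⟩
    r x + m * lam ∎
    where open ≡-Reasoning

sum-*-sum : ∀ {n} (f g : Fin n → ℕ) → sum f * sum g ≡ sum (λ p → sum (λ q → f p * g q))
sum-*-sum f g = trans (*-distribʳ-sum (sum g) f) (sum-cong-≗ (λ p → *-distribˡ-sum (f p) g))

module SymmetricDesign {m} (Blk : Fin (suc m) → Fin (suc m) → Bool) {k lam}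
  (design : Is2Design Blk k lam) (1<k : 1 < k) where

  open TwoDesign Blk design
  open ≡-Reasoning

  replication≡k : ∀ x → r x ≡ k
  replication≡k x = trans (r≡r₀ x) (sym k≡r₀)
    where
    r≡r₀ : ∀ x → r x ≡ r zero
    r≡r₀ x = same-solution (r x) (r zero) 1<k (replication x) (replication zero)
    k≡r₀ : k ≡ r zero
    k≡r₀ = ℕ.*-cancelˡ-≡ k (r zero) (suc m)
      (trans block-count (trans (sum-cong-≗ r≡r₀) (sum-const (suc m) (r zero))))

  fisher : k * k ≡ k + m * lam
  fisher = subst (λ r → r * k ≡ r + m * lam) (replication≡k zero) (replication zero)

  X : Fin (suc m) → Fin (suc m) → ℕ
  X i j = count (λ x → Blk i x ∧ Blk j x)

  X-diagonal : ∀ j → X j j ≡ k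
  X-diagonal j = trans (count-cong (λ x → ∧-idem (Blk j x))) (proj₁ design j)

  first-moment : ∀ j → sum (X j) ≡ k * k
  first-moment j = begin
    sum (X j)
      ≡⟨ sum-cong-≗ (λ i → count-∧ (Blk j) (Blk i)) ⟩
    sum (λ i → sum (λ x → χ (Blk j x) * χ (Blk i x)))
      ≡⟨ ∑-comm (λ i x → χ (Blk j x) * χ (Blk i x)) ⟩
    sum (λ x → sum (λ i → χ (Blk j x) * χ (Blk i x)))
      ≡⟨ sum-cong-≗ (λ x → *-distribˡ-sum (χ (Blk j x)) (λ i → χ (Blk i x))) ⟨
    sum (λ x → χ (Blk j x) * sum (λ i → χ (Blk i x)))
      ≡⟨ sum-cong-≗ (λ x → cong (χ (Blk j x) *_)
           (trans (sym (count≡sum (λ i → Blk i x))) (replication≡k x))) ⟩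
    sum (λ x → χ (Blk j x) * k)
      ≡⟨ *-distribʳ-sum k (χ ∘ Blk j) ⟨
    sum (χ ∘ Blk j) * k
      ≡⟨ cong (_* k) (trans (sym (count≡sum (Blk j))) (proj₁ design j)) ⟩
    k * k ∎

  c : Fin (suc m) → Fin (suc m) → ℕ
  c p q = count (λ i → Blk i p ∧ Blk i q)

  -- q = p contributes r p = k, and each of the other k − 1 points q of block j contributes λ
  pairs-through : ∀ j p → Blk j p ≡ true → sum (λ q → χ (Blk j q) * c p q) + lam ≡ k + k * lam
  pairs-through j p Bjp = begin
    sum (λ q → χ (Blk j q) * c p q) + lam
      ≡⟨ cong (_+ lam) (sum-remove (λ q → χ (Blk j q) * c p q)) ⟩
    χ (Blk j p) * c p p + sum (λ i → χ (Blk j (punchIn p i)) * c p (punchIn p i)) + lam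
      ≡⟨ cong₂ (λ a s → a + s + lam) c-pp (sum-cong-≗ (λ i → cong (χ (Blk j (punchIn p i)) *_)
           (proj₂ design p (punchIn p i) (punchInᵢ≢i p i ∘ sym)))) ⟩
    k + sum (λ i → χ (Blk j (punchIn p i)) * lam) + lam
      ≡⟨ cong (λ s → k + s + lam) (*-distribʳ-sum lam (χ ∘ removeAt (Blk j) p)) ⟨
    k + sum (χ ∘ removeAt (Blk j) p) * lam + lam
      ≡⟨ cong (λ s → k + s * lam + lam) (count≡sum (removeAt (Blk j) p)) ⟨
    k + count (removeAt (Blk j) p) * lam + lam
      ≡⟨ rearrange k (count (removeAt (Blk j) p)) lam ⟩
    k + suc (count (removeAt (Blk j) p)) * lam
      ≡⟨ cong (λ s → k + s * lam) (trans (sym (count-remove (Blk j) Bjp)) (proj₁ design j)) ⟩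
    k + k * lam ∎
    where
    c-pp : χ (Blk j p) * c p p ≡ k
    c-pp rewrite Bjp = trans (ℕ.+-identityʳ (c p p))
      (trans (count-cong (λ i → ∧-idem (Blk i p))) (replication≡k p))
    rearrange : ∀ k n l → k + n * l + l ≡ k + (1 + n) * l
    rearrange = solve-∀

  second-moment : ∀ j → sum (λ i → X j i * X j i) + k * lam ≡ k * (k + k * lam)
  second-moment j = begin
    sum (λ i → X j i * X j i) + k * lam
      ≡⟨ cong₂ _+_ expand (trans (cong (_* lam) (sym size)) (*-distribʳ-sum lam (χ ∘ Blk j))) ⟩
    sum (λ p → χ (Blk j p) * sum (λ q → χ (Blk j q) * c p q)) + sum (λ p → χ (Blk j p) * lam)
      ≡⟨ ∑-distrib-+ (λ p → χ (Blk j p) * sum (λ q → χ (Blk j q) * c p q)) (λ p → χ (Blk j p) * lam) ⟨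
    sum (λ p → χ (Blk j p) * sum (λ q → χ (Blk j q) * c p q) + χ (Blk j p) * lam)
      ≡⟨ sum-cong-≗ (λ p → per-point p (Blk j p) refl) ⟩
    sum (λ p → χ (Blk j p) * (k + k * lam))
      ≡⟨ *-distribʳ-sum (k + k * lam) (χ ∘ Blk j) ⟨
    sum (χ ∘ Blk j) * (k + k * lam)
      ≡⟨ cong (_* (k + k * lam)) size ⟩
    k * (k + k * lam) ∎
    where
    size : sum (χ ∘ Blk j) ≡ k
    size = trans (sym (count≡sum (Blk j))) (proj₁ design j)
    per-point : ∀ p b → Blk j p ≡ b →
      χ (Blk j p) * sum (λ q → χ (Blk j q) * c p q) + χ (Blk j p) * lam ≡ χ (Blk j p) * (k + k * lam)
    per-point p true Bjp rewrite Bjp =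
      trans (cong₂ _+_ (ℕ.+-identityʳ _) (ℕ.+-identityʳ lam))
        (trans (pairs-through j p Bjp) (sym (ℕ.+-identityʳ _)))
    per-point p false Bjp rewrite Bjp = refl
    expand : sum (λ i → X j i * X j i) ≡ sum (λ p → χ (Blk j p) * sum (λ q → χ (Blk j q) * c p q))
    expand = begin
      sum (λ i → X j i * X j i)
        ≡⟨ sum-cong-≗ (λ i → trans (cong₂ _*_ (count-∧ (Blk j) (Blk i)) (count-∧ (Blk j) (Blk i)))
                                    (sum-*-sum (λ p → χ (Blk j p) * χ (Blk i p)) (λ q → χ (Blk j q) * χ (Blk i q)))) ⟩
      sum (λ i → sum (λ p → sum (λ q → (χ (Blk j p) * χ (Blk i p)) * (χ (Blk j q) * χ (Blk i q)))))
        ≡⟨ ∑-comm (λ i p → sum (λ q → (χ (Blk j p) * χ (Blk i p)) * (χ (Blk j q) * χ (Blk i q)))) ⟩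
      sum (λ p → sum (λ i → sum (λ q → (χ (Blk j p) * χ (Blk i p)) * (χ (Blk j q) * χ (Blk i q)))))
        ≡⟨ sum-cong-≗ (λ p → ∑-comm (λ i q → (χ (Blk j p) * χ (Blk i p)) * (χ (Blk j q) * χ (Blk i q)))) ⟩
      sum (λ p → sum (λ q → sum (λ i → (χ (Blk j p) * χ (Blk i p)) * (χ (Blk j q) * χ (Blk i q)))))
        ≡⟨ sum-cong-≗ (λ p → sum-cong-≗ (λ q → regroup p q)) ⟩
      sum (λ p → sum (λ q → χ (Blk j p) * (χ (Blk j q) * c p q)))
        ≡⟨ sum-cong-≗ (λ p → *-distribˡ-sum (χ (Blk j p)) (λ q → χ (Blk j q) * c p q)) ⟨
      sum (λ p → χ (Blk j p) * sum (λ q → χ (Blk j q) * c p q)) ∎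
      where
      shuffle : ∀ a b c d → (a * b) * (c * d) ≡ (a * c) * (b * d)
      shuffle = solve-∀
      assoc : ∀ a b s → (a * b) * s ≡ a * (b * s)
      assoc = solve-∀
      regroup : ∀ p q → sum (λ i → (χ (Blk j p) * χ (Blk i p)) * (χ (Blk j q) * χ (Blk i q)))
                        ≡ χ (Blk j p) * (χ (Blk j q) * c p q)
      regroup p q = begin
        sum (λ i → (χ (Blk j p) * χ (Blk i p)) * (χ (Blk j q) * χ (Blk i q)))
          ≡⟨ sum-cong-≗ (λ i → shuffle (χ (Blk j p)) (χ (Blk i p)) (χ (Blk j q)) (χ (Blk i q))) ⟩
        sum (λ i → (χ (Blk j p) * χ (Blk j q)) * (χ (Blk i p) * χ (Blk i q)))
          ≡⟨ *-distribˡ-sum (χ (Blk j p) * χ (Blk j q)) (λ i → χ (Blk i p) * χ (Blk i q)) ⟨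
        (χ (Blk j p) * χ (Blk j q)) * sum (λ i → χ (Blk i p) * χ (Blk i q))
          ≡⟨ cong ((χ (Blk j p) * χ (Blk j q)) *_) (count-∧ (λ i → Blk i p) (λ i → Blk i q)) ⟨
        (χ (Blk j p) * χ (Blk j q)) * c p q
          ≡⟨ assoc (χ (Blk j p)) (χ (Blk j q)) (c p q) ⟩
        χ (Blk j p) * (χ (Blk j q) * c p q) ∎

  blocks-meet : ∀ j j′ → j ≢ j′ → X j j′ ≡ lam
  blocks-meet j j′ j≢j′ = trans (cong (X j) (sym (punchIn-punchOut j≢j′)))
    (constant-from-moments (removeAt (X j) j) lam first-off-diagonal second-off-diagonal (punchOut j≢j′))
    where
    S₁ = sum (removeAt (X j) j)
    S₂ = sum (λ i → X j (punchIn j i) * X j (punchIn j i))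
    first-off-diagonal : S₁ ≡ m * lam
    first-off-diagonal = ℕ.+-cancelˡ-≡ k S₁ (m * lam) (begin
      k + S₁          ≡⟨ cong (_+ S₁) (X-diagonal j) ⟨
      X j j + S₁      ≡⟨ sum-remove (X j) ⟨
      sum (X j)       ≡⟨ first-moment j ⟩
      k * k           ≡⟨ fisher ⟩
      k + m * lam     ∎)
    second-off-diagonal : S₂ ≡ m * (lam * lam)
    second-off-diagonal = ℕ.+-cancelˡ-≡ (k * k) S₂ (m * (lam * lam))
      (ℕ.+-cancelʳ-≡ (k * lam) (k * k + S₂) (k * k + m * (lam * lam)) (begin
        k * k + S₂ + k * lam                ≡⟨ cong (λ x → x * x + S₂ + k * lam) (X-diagonal j) ⟨
        X j j * X j j + S₂ + k * lam        ≡⟨ cong (_+ k * lam) (sum-remove (λ i → X j i * X j i)) ⟨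
        sum (λ i → X j i * X j i) + k * lam ≡⟨ second-moment j ⟩
        k * (k + k * lam)                   ≡⟨ expand k lam ⟩
        k * k + (k * k) * lam               ≡⟨ cong (λ s → k * k + s * lam) fisher ⟩
        k * k + (k + m * lam) * lam         ≡⟨ regroup k m lam ⟩
        k * k + m * (lam * lam) + k * lam   ∎))
      where
      expand : ∀ k l → k * (k + k * l) ≡ k * k + (k * k) * l
      expand = solve-∀
      regroup : ∀ k m l → k * k + (k + m * l) * l ≡ k * k + m * (l * l) + k * l
      regroup = solve-∀

GF3-+-commutativeMonoid : CommutativeMonoid _ _
GF3-+-commutativeMonoid = CommutativeSemiring.+-commutativeMonoid GF3-commutativeSemiring

module BiplaneCode {m} (D : Fin (suc m) → Fin (suc m) → Bool) {k}
  (biplane : Is2Design (λ j p → D p j) k 2) (3≤k : 3 ≤ k) (k≡2 : ℕ→GF3 k ≡ 𝟚) where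

  open SymmetricDesign (λ j p → D p j) biplane (ℕ.≤-trans (s≤s (s≤s z≤n)) 3≤k)
    using (X; X-diagonal; blocks-meet)

  N : (Fin (suc m) → Bool) → Fin (suc m) → ℕ
  N y p = count (λ j → D p j ∧ y j)

  X≡2-mod-3 : ∀ j j′ → ℕ→GF3 (X j j′) ≡ 𝟚
  X≡2-mod-3 j j′ with j ≟ j′
  ... | yes refl = trans (cong ℕ→GF3 (X-diagonal j)) k≡2
  ... | no j≢j′ = cong ℕ→GF3 (blocks-meet j j′ j≢j′)

  block-sum : ∀ y j₀ → sum (λ p → χ (D p j₀) * N y p) ≡ sum (λ j → χ (y j) * X j₀ j)
  block-sum y j₀ = begin
    sum (λ p → χ (D p j₀) * N y p)
      ≡⟨ sum-cong-≗ (λ p → trans (cong (χ (D p j₀) *_) (count-∧ (D p) y))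
                                 (*-distribˡ-sum (χ (D p j₀)) (λ j → χ (D p j) * χ (y j)))) ⟩
    sum (λ p → sum (λ j → χ (D p j₀) * (χ (D p j) * χ (y j))))
      ≡⟨ ∑-comm (λ p j → χ (D p j₀) * (χ (D p j) * χ (y j))) ⟩
    sum (λ j → sum (λ p → χ (D p j₀) * (χ (D p j) * χ (y j))))
      ≡⟨ sum-cong-≗ (λ j → sum-cong-≗ (λ p → rotate (χ (D p j₀)) (χ (D p j)) (χ (y j)))) ⟩
    sum (λ j → sum (λ p → χ (y j) * (χ (D p j₀) * χ (D p j))))
      ≡⟨ sum-cong-≗ (λ j → trans (sym (*-distribˡ-sum (χ (y j)) (λ p → χ (D p j₀) * χ (D p j))))
                                 (cong (χ (y j) *_) (sym (count-∧ (λ p → D p j₀) (λ p → D p j))))) ⟩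
    sum (λ j → χ (y j) * X j₀ j) ∎
    where
    open ≡-Reasoning
    rotate : ∀ a b c → a * (b * c) ≡ c * (a * b)
    rotate = solve-∀

  block-sum≡𝟘 : ∀ y j₀ → ℕ→GF3 (count y) ≡ 𝟘 → ℕ→GF3 (sum (λ p → χ (D p j₀) * N y p)) ≡ 𝟘
  block-sum≡𝟘 y j₀ count≡𝟘 = begin
    ℕ→GF3 (sum (λ p → χ (D p j₀) * N y p))
      ≡⟨ cong ℕ→GF3 (block-sum y j₀) ⟩
    ℕ→GF3 (sum (λ j → χ (y j) * X j₀ j))
      ≡⟨ ℕ→GF3-sum (λ j → χ (y j) * X j₀ j) ⟩
    Σ₃.sum (λ j → ℕ→GF3 (χ (y j) * X j₀ j))
      ≡⟨ Σ₃.sum-cong-≗ (λ j → trans (ℕ→GF3-* (χ (y j)) (X j₀ j))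
                                    (cong (ℕ→GF3 (χ (y j)) ⊗_) (X≡2-mod-3 j₀ j))) ⟩
    Σ₃.sum (λ j → ℕ→GF3 (χ (y j)) ⊗ 𝟚)
      ≡⟨ Σ₃.*-distribʳ-sum 𝟚 (ℕ→GF3 ∘ χ ∘ y) ⟨
    Σ₃.sum (ℕ→GF3 ∘ χ ∘ y) ⊗ 𝟚
      ≡⟨ cong (_⊗ 𝟚) (trans (sym (ℕ→GF3-sum (χ ∘ y))) (cong ℕ→GF3 (sym (count≡sum y)))) ⟩
    ℕ→GF3 (count y) ⊗ 𝟚
      ≡⟨ cong (_⊗ 𝟚) count≡𝟘 ⟩
    𝟘 ∎
    where open ≡-Reasoning

  second-block : ∀ {B a b} → a ≢ b → D a B ≡ true → D b B ≡ true →
    ∃ λ j → j ≢ B × D a j ≡ true × D b j ≡ true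
  second-block {B} {a} {b} a≢b DaB DbB =
    let j , both∖B-j = count-member (both ∖ B) (≤-count-∖ both (cong₂ _∧_ DaB DbB) 2≤count)
        j≢B , both-j = ∖-member⁻ both both∖B-j
    in j , j≢B , ∧≡true both-j
    where
    both : Fin (suc m) → Bool
    both j = D a j ∧ D b j
    2≤count : 2 ≤ count both
    2≤count = ℕ.≤-reflexive (sym (proj₂ biplane a b a≢b))

  module _ (y : Fin (suc m) → Bool) (B : Fin (suc m))
    (outside : ∀ p → D p B ≡ false → ℕ→GF3 (N y p) ≡ 𝟘) where

    pair-sum : ∀ {j u w} → j ≢ B → u ≢ w →
      D u B ≡ true → D w B ≡ true → D u j ≡ true → D w j ≡ true →
      ℕ→GF3 (sum (λ p → χ (D p j) * N y p)) ≡ ℕ→GF3 (N y u) ⊕ ℕ→GF3 (N y w)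
    pair-sum {j} {u} {w} j≢B u≢w DuB DwB Duj Dwj = begin
      ℕ→GF3 (sum t)
        ≡⟨ ℕ→GF3-sum t ⟩
      Σ₃.sum (ℕ→GF3 ∘ t)
        ≡⟨ sum-supported-on-pair GF3-+-commutativeMonoid (ℕ→GF3 ∘ t) u≢w vanishes ⟩
      ℕ→GF3 (t u) ⊕ ℕ→GF3 (t w)
        ≡⟨ cong₂ _⊕_ (on-block Duj) (on-block Dwj) ⟩
      ℕ→GF3 (N y u) ⊕ ℕ→GF3 (N y w) ∎
      where
      open ≡-Reasoning
      t : Fin (suc m) → ℕ
      t p = χ (D p j) * N y p
      on-block : ∀ {p} → D p j ≡ true → ℕ→GF3 (t p) ≡ ℕ→GF3 (N y p)
      on-block {p} Dpj rewrite Dpj = cong ℕ→GF3 (ℕ.+-identityʳ (N y p))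
      vanishes : ∀ p → p ≢ u → p ≢ w → ℕ→GF3 (t p) ≡ 𝟘
      vanishes p p≢u p≢w = ℕ→GF3-χ* (D p j) (N y p) λ Dpj → outside p (¬-not λ DpB →
        [ p≢u , p≢w ]′ (count≡2-member⇒≡⊎≡ (λ x → D x j ∧ D x B) (blocks-meet j B j≢B) u≢w
                          (cong₂ _∧_ Duj DuB) (cong₂ _∧_ Dwj DwB) (cong₂ _∧_ Dpj DpB)))

    orthogonal : ℕ→GF3 (count y) ≡ 𝟘 → ∀ p → ℕ→GF3 (N y p) ≡ 𝟘
    orthogonal count≡𝟘 p with D p B in DpB
    ... | false = outside p DpB
    ... | true with two-more-members (λ q → D q B) (subst (3 ≤_) (sym (proj₁ biplane B)) 3≤k) DpB
    ...   | u , w , DuB , DwB , u≢p , w≢p , w≢u =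
      pairwise-sums≡𝟘⇒≡𝟘 _ _ _
        (pair (u≢p ∘ sym) DpB DuB) (pair (w≢p ∘ sym) DpB DwB) (pair (w≢u ∘ sym) DuB DwB)
      where
      pair : ∀ {a b} → a ≢ b → D a B ≡ true → D b B ≡ true → ℕ→GF3 (N y a) ⊕ ℕ→GF3 (N y b) ≡ 𝟘
      pair a≢b DaB DbB with second-block a≢b DaB DbB
      ... | j , j≢B , Daj , Dbj = trans (sym (pair-sum j≢B a≢b DaB DbB Daj Dbj)) (block-sum≡𝟘 y j count≡𝟘)

-- The code of the biplane on 56 points

bool→GF3-∧ : ∀ a b → bool→GF3 a ⊗ bool→GF3 b ≡ ℕ→GF3 (χ (a ∧ b))
bool→GF3-∧ true true = refl
bool→GF3-∧ true false = refl
bool→GF3-∧ false b = refl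

isOne?-bool→GF3 : ∀ b → isOne? (bool→GF3 b) ≡ b
isOne?-bool→GF3 true = refl
isOne?-bool→GF3 false = refl

nonzero?-bool→GF3 : ∀ b → nonzero? (bool→GF3 b) ≡ b
nonzero?-bool→GF3 true = refl
nonzero?-bool→GF3 false = refl

bool→GF3-01 : ∀ b → (bool→GF3 b ≡ 𝟘) ⊎ (bool→GF3 b ≡ 𝟙)
bool→GF3-01 true = inj₂ refl
bool→GF3-01 false = inj₁ refl

·-congʳ : ∀ {n} (x : Fin n → GF3) {y y′ : Fin n → GF3} → (∀ j → y j ≡ y′ j) → x · y ≡ x · y′
·-congʳ x {y} {y′} y≗y′ = trans (Σ3≡sum (λ j → x j ⊗ y j))
  (trans (Σ₃.sum-cong-≗ (λ j → cong (x j ⊗_) (y≗y′ j))) (sym (Σ3≡sum (λ j → x j ⊗ y′ j))))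

indicator-· : ∀ {n} (x y : Fin n → Bool) →
  (bool→GF3 ∘ x) · (bool→GF3 ∘ y) ≡ ℕ→GF3 (count (λ j → x j ∧ y j))
indicator-· x y = begin
  (bool→GF3 ∘ x) · (bool→GF3 ∘ y)                   ≡⟨ Σ3≡sum (λ j → bool→GF3 (x j) ⊗ bool→GF3 (y j)) ⟩
  Σ₃.sum (λ j → bool→GF3 (x j) ⊗ bool→GF3 (y j))    ≡⟨ Σ₃.sum-cong-≗ (λ j → bool→GF3-∧ (x j) (y j)) ⟩
  Σ₃.sum (λ j → ℕ→GF3 (χ (x j ∧ y j)))              ≡⟨ ℕ→GF3-sum (λ j → χ (x j ∧ y j)) ⟨
  ℕ→GF3 (sum (λ j → χ (x j ∧ y j)))                 ≡⟨ cong ℕ→GF3 (count≡sum (λ j → x j ∧ y j)) ⟨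
  ℕ→GF3 (count (λ j → x j ∧ y j))                   ∎
  where open ≡-Reasoning

rows-orthogonal⇒InDual : ∀ D y → (∀ p → row D p · y ≡ 𝟘) → InDual D y
rows-orthogonal⇒InDual D y rows⊥y x (c , x≡∑) = begin
  x · y
    ≡⟨ Σ3≡sum (λ j → x j ⊗ y j) ⟩
  Σ₃.sum (λ j → x j ⊗ y j)
    ≡⟨ Σ₃.sum-cong-≗ (λ j → cong (_⊗ y j) (trans (x≡∑ j) (Σ3≡sum (λ p → c p ⊗ row D p j)))) ⟩
  Σ₃.sum (λ j → Σ₃.sum (λ p → c p ⊗ row D p j) ⊗ y j)
    ≡⟨ Σ₃.sum-cong-≗ (λ j → Σ₃.*-distribʳ-sum (y j) (λ p → c p ⊗ row D p j)) ⟩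
  Σ₃.sum (λ j → Σ₃.sum (λ p → (c p ⊗ row D p j) ⊗ y j))
    ≡⟨ Σ₃.∑-comm (λ j p → (c p ⊗ row D p j) ⊗ y j) ⟩
  Σ₃.sum (λ p → Σ₃.sum (λ j → (c p ⊗ row D p j) ⊗ y j))
    ≡⟨ Σ₃.sum-cong-≗ (λ p → Σ₃.sum-cong-≗ (λ j → ⊗-assoc (c p) (row D p j) (y j))) ⟩
  Σ₃.sum (λ p → Σ₃.sum (λ j → c p ⊗ (row D p j ⊗ y j)))
    ≡⟨ Σ₃.sum-cong-≗ (λ p → Σ₃.*-distribˡ-sum (c p) (λ j → row D p j ⊗ y j)) ⟨
  Σ₃.sum (λ p → c p ⊗ Σ₃.sum (λ j → row D p j ⊗ y j))
    ≡⟨ Σ₃.sum-cong-≗ (λ p → trans (cong (c p ⊗_) (trans (sym (Σ3≡sum (λ j → row D p j ⊗ y j))) (rows⊥y p)))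
                                  (⊗-comm (c p) 𝟘)) ⟩
  Σ₃.sum {56} (λ _ → 𝟘)
    ≡⟨ Σ₃.sum-replicate-zero 56 ⟩
  𝟘 ∎
  where open ≡-Reasoning

blocks-differ : ∀ {v b} {Blk : Fin b → Fin v → Bool} {k lam a c} →
  Is2Design Blk k lam → IsQuasiSymmetric Blk a c → k ≢ a → k ≢ c →
  ∀ i i′ → i ≢ i′ → ∃ λ x → Blk i x ≢ Blk i′ x
blocks-differ {v} {Blk = Blk} {k} design quasi k≢a k≢c i i′ i≢i′ =
  ¬∀⟶∃¬ v (λ x → Blk i x ≡ Blk i′ x) (λ x → Blk i x ≟ᵇ Blk i′ x) same-blocks-absurd
  where
  same-blocks-absurd : ¬ (∀ x → Blk i x ≡ Blk i′ x)
  same-blocks-absurd same =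
    [ k≢a ∘ trans (sym meet≡k) , k≢c ∘ trans (sym meet≡k) ]′ (quasi i i′ i≢i′)
    where
    meet≡k : count (λ x → Blk i x ∧ Blk i′ x) ≡ k
    meet≡k = trans (count-cong (λ x → trans (cong (Blk i x ∧_) (sym (same x))) (∧-idem (Blk i x))))
                   (proj₁ design i)

if-guard : ∀ g {x} → (g ≡ true → x ≡ false) → (if g then 𝟘 else bool→GF3 x) ≡ bool→GF3 x
if-guard true g→¬x = cong bool→GF3 (sym (g→¬x refl))
if-guard false g→¬x = refl

not-guard-∧ : ∀ g {x} → (g ≡ true → x ≡ false) → not g ∧ x ≡ x
not-guard-∧ true g→¬x = sym (g→¬x refl)
not-guard-∧ false g→¬x = refl

module Extension (D : Fin 56 → Fin 56 → Bool) (biplane : IsBiplane56 D) (B : Fin 56)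
  (b : ℕ) (Bhat : Fin b → Fin 56 → Bool) (design : Is2Design Bhat 12 9) (quasi : IsQuasiSymmetric Bhat 0 3)
  (z : Fin 56) (φ : Fin 56 ↔ Fin 56) (derived : DerivedIsDualResidual D B Bhat z φ) where

  open Inverse φ using () renaming (to to φ→; from to φ←)
  open TwoDesign Bhat design using (r; replication; block-count)
  open BiplaneCode D biplane (s≤s (s≤s (s≤s z≤n))) refl using (N; orthogonal)

  φ←B≡z : φ← B ≡ z
  φ←B≡z = trans (cong φ← (sym (proj₁ derived))) (Inverse.strictlyInverseʳ φ z)

  r≡45 : ∀ x → r x ≡ 45
  r≡45 x = ℕ.*-cancelʳ-≡ (r x) 45 11 (*-suc-cancel (r x) 11 (55 * 9) (replication x))

  b≡210 : b ≡ 210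
  b≡210 = ℕ.*-cancelʳ-≡ b 210 12 (trans block-count (trans (sum-cong-≗ r≡45) (sum-const 56 45)))

  avoid-z : Fin b → Bool
  avoid-z i = not (Bhat i z)

  -- opaque, so that transporting the enumeration along this equation never unfolds its proof
  opaque
    count-avoid-z : count avoid-z ≡ 165
    count-avoid-z = ℕ.+-cancelʳ-≡ 45 (count avoid-z) 165
      (trans (cong (count avoid-z +_) (sym (r≡45 z))) (trans (count-complement (λ i → Bhat i z)) b≡210))

  word : Fin b → Fin 56 → Bool
  word i j = Bhat i (φ← j)

  word-φ : ∀ i x → word i (φ→ x) ≡ Bhat i x
  word-φ i x = cong (Bhat i) (Inverse.strictlyInverseʳ φ x)

  count-words : ∀ (f : Fin 56 → Bool) (Q : Fin 56 → Bool) → (∀ x → f (φ→ x) ≡ Q x) → count f ≡ count Q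
  count-words f Q f∘φ≗Q = trans (sym (count-permute φ f)) (count-cong {P = f ∘ φ→} {Q = Q} f∘φ≗Q)

  module _ {i} (z∉i : Bhat i z ≡ false) where

    word-B : word i B ≡ false
    word-B = trans (cong (Bhat i) φ←B≡z) z∉i

    word-on-B : ∀ j → (j == B) ≡ true → word i j ≡ false
    word-on-B j j==B = trans (cong (word i) (==⇒≡ j==B)) word-B

    blockWord≡ : ∀ j → blockWord B Bhat φ i j ≡ bool→GF3 (word i j)
    blockWord≡ j = if-guard (j == B) (word-on-B j)

    off-B : ∀ j → not (j == B) ∧ word i j ≡ word i j
    off-B j = not-guard-∧ (j == B) (word-on-B j)

    word-size : count (word i) ≡ 12
    word-size = trans (count-words (word i) (Bhat i) (word-φ i)) (proj₁ design i)

    N-outside : ∀ p → D p B ≡ false → (N (word i) p ≡ 0) ⊎ (N (word i) p ≡ 3)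
    N-outside p DpB = subst (λ n → (n ≡ 0) ⊎ (n ≡ 3)) (sym N≡meet) (quasi i′ i i′≢i)
      where
      ψ : Σ (Fin b) (λ i → T (Bhat i z)) ↔ Σ (Fin 56) (λ p → T (not (D p B)))
      ψ = proj₁ (proj₂ derived)
      p-block : Σ (Fin b) (λ i → T (Bhat i z))
      p-block = Inverse.from ψ (p , subst (T ∘ not) (sym DpB) tt)
      i′ : Fin b
      i′ = proj₁ p-block
      ψp≡p : proj₁ (Inverse.to ψ p-block) ≡ p
      ψp≡p = cong proj₁ (Inverse.strictlyInverseˡ ψ _)
      i′≢i : i′ ≢ i
      i′≢i i′≡i = subst T (trans (cong (λ i → Bhat i z) i′≡i) z∉i) (proj₂ p-block)
      incidence : ∀ x → D p (φ→ x) ∧ Bhat i x ≡ Bhat i′ x ∧ Bhat i x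
      incidence x with x ≟ z
      ... | yes refl rewrite z∉i = trans (∧-zeroʳ _) (sym (∧-zeroʳ _))
      ... | no x≢z = cong (_∧ Bhat i x)
        (sym (trans (proj₂ (proj₂ derived) p-block x x≢z) (cong (λ q → D q (φ→ x)) ψp≡p)))
      N≡meet : N (word i) p ≡ count (λ x → Bhat i′ x ∧ Bhat i x)
      N≡meet = count-words (λ j → D p j ∧ word i j) (λ x → Bhat i′ x ∧ Bhat i x)
        (λ x → trans (cong (D p (φ→ x) ∧_) (word-φ i x)) (incidence x))

    in-dual : InDual D (blockWord B Bhat φ i)
    in-dual = rows-orthogonal⇒InDual D (blockWord B Bhat φ i) λ p → begin
      row D p · blockWord B Bhat φ i       ≡⟨ ·-congʳ (row D p) blockWord≡ ⟩
      row D p · (bool→GF3 ∘ word i)        ≡⟨ indicator-· (D p) (word i) ⟩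
      ℕ→GF3 (N (word i) p)                 ≡⟨ orthogonal (word i) B outside (cong ℕ→GF3 word-size) p ⟩
      𝟘                                    ∎
      where
      open ≡-Reasoning
      outside : ∀ p → D p B ≡ false → ℕ→GF3 (N (word i) p) ≡ 𝟘
      outside p DpB = [ cong ℕ→GF3 , cong ℕ→GF3 ]′ (N-outside p DpB)

  θ : Fin 165 ↔ Members avoid-z
  θ = subst (λ n → Fin n ↔ Members avoid-z) count-avoid-z (enumerate avoid-z)

  blk : Fin 165 → Fin b
  blk k = proj₁ (Inverse.to θ k)

  z∉blk : ∀ k → Bhat (blk k) z ≡ false
  z∉blk k = Equivalence.to T-not-≡ (proj₂ (Inverse.to θ k))

  blk-injective : ∀ {k l} → blk k ≡ blk l → k ≡ l
  blk-injective {k} {l} blk≡ = begin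
    k                               ≡⟨ Inverse.strictlyInverseʳ θ k ⟨
    Inverse.from θ (Inverse.to θ k) ≡⟨ cong (Inverse.from θ) (members-≡ blk≡) ⟩
    Inverse.from θ (Inverse.to θ l) ≡⟨ Inverse.strictlyInverseʳ θ l ⟩
    l                               ∎
    where open ≡-Reasoning

  vs : Fin 165 → Word
  vs k = blockWord B Bhat φ (blk k)

  isOne?-vs : ∀ k j → isOne? (vs k j) ≡ word (blk k) j
  isOne?-vs k j = trans (cong isOne? (blockWord≡ (z∉blk k) j)) (isOne?-bool→GF3 (word (blk k) j))

  vs∈SB : ∀ k → InSB D B (vs k)
  vs∈SB k = (in-dual (z∉blk k) , zero-one , weight≡12) , vs-B
    where
    zero-one : Is01 (vs k)
    zero-one j =
      subst (λ v → (v ≡ 𝟘) ⊎ (v ≡ 𝟙)) (sym (blockWord≡ (z∉blk k) j)) (bool→GF3-01 (word (blk k) j))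
    weight≡12 : weight (vs k) ≡ 12
    weight≡12 = trans (count-cong {P = λ j → nonzero? (vs k j)} {Q = word (blk k)}
                        (λ j → trans (cong nonzero? (blockWord≡ (z∉blk k) j)) (nonzero?-bool→GF3 _)))
                      (word-size (z∉blk k))
    vs-B : vs k B ≡ 𝟘
    vs-B = trans (blockWord≡ (z∉blk k) B) (cong bool→GF3 (word-B (z∉blk k)))

  vs-distinct : ∀ k l → k ≢ l → ∃ λ j → vs k j ≢ vs l j
  vs-distinct k l k≢l
    with blocks-differ {Blk = Bhat} design quasi (λ ()) (λ ()) (blk k) (blk l) (k≢l ∘ blk-injective)
  ... | x , differ = φ→ x , λ same → differ (begin
    Bhat (blk k) x            ≡⟨ word-φ (blk k) x ⟨
    word (blk k) (φ→ x)       ≡⟨ isOne?-vs k (φ→ x) ⟨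
    isOne? (vs k (φ→ x))      ≡⟨ cong isOne? same ⟩
    isOne? (vs l (φ→ x))      ≡⟨ isOne?-vs l (φ→ x) ⟩
    word (blk l) (φ→ x)       ≡⟨ word-φ (blk l) x ⟩
    Bhat (blk l) x            ∎)
    where open ≡-Reasoning

  vs-size : ∀ k → count (λ j → not (j == B) ∧ isOne? (vs k j)) ≡ 12
  vs-size k = trans (count-cong {P = λ j → not (j == B) ∧ isOne? (vs k j)} {Q = word (blk k)}
                      (λ j → trans (cong (not (j == B) ∧_) (isOne?-vs k j)) (off-B (z∉blk k) j)))
                    (word-size (z∉blk k))

  vs-replication : ∀ j → j ≢ B → count (λ k → isOne? (vs k j)) ≡ 36
  vs-replication j j≢B = ℕ.+-cancelʳ-≡ 9 _ 36 (begin
    count (λ k → isOne? (vs k j)) + 9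
      ≡⟨ cong₂ _+_ (count-cong {P = λ k → isOne? (vs k j)} {Q = λ k → Bhat (blk k) x} (λ k → isOne?-vs k j))
                   (sym (proj₂ design z x z≢x)) ⟩
    count (λ k → Bhat (blk k) x) + count (λ i → Bhat i z ∧ Bhat i x)
      ≡⟨ cong (_+ count (λ i → Bhat i z ∧ Bhat i x)) (count-reindex avoid-z θ (λ i → Bhat i x)) ⟩
    count (λ i → not (Bhat i z) ∧ Bhat i x) + count (λ i → Bhat i z ∧ Bhat i x)
      ≡⟨ count-split (λ i → Bhat i z) (λ i → Bhat i x) ⟩
    r x
      ≡⟨ r≡45 x ⟩
    45 ∎)
    where
    open ≡-Reasoning
    x : Fin 56
    x = φ← j
    z≢x : z ≢ x
    z≢x z≡x = j≢B (trans (sym (Inverse.strictlyInverseˡ φ j)) (trans (cong φ→ (sym z≡x)) (proj₁ derived)))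

  vs-meet : ∀ k l → k ≢ l →
    (count (λ j → not (j == B) ∧ isOne? (vs k j) ∧ isOne? (vs l j)) ≡ 0) ⊎
    (count (λ j → not (j == B) ∧ isOne? (vs k j) ∧ isOne? (vs l j)) ≡ 3)
  vs-meet k l k≢l =
    subst (λ n → (n ≡ 0) ⊎ (n ≡ 3)) (sym meet≡) (quasi (blk k) (blk l) (k≢l ∘ blk-injective))
    where
    pointwise : ∀ x → not (φ→ x == B) ∧ isOne? (vs k (φ→ x)) ∧ isOne? (vs l (φ→ x))
                      ≡ Bhat (blk k) x ∧ Bhat (blk l) x
    pointwise x = begin
      not (φ→ x == B) ∧ isOne? (vs k (φ→ x)) ∧ isOne? (vs l (φ→ x))
        ≡⟨ cong₂ (λ a c → not (φ→ x == B) ∧ a ∧ c) (isOne?-vs k (φ→ x)) (isOne?-vs l (φ→ x)) ⟩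
      not (φ→ x == B) ∧ word (blk k) (φ→ x) ∧ word (blk l) (φ→ x)
        ≡⟨ ∧-assoc (not (φ→ x == B)) _ _ ⟨
      (not (φ→ x == B) ∧ word (blk k) (φ→ x)) ∧ word (blk l) (φ→ x)
        ≡⟨ cong (_∧ word (blk l) (φ→ x)) (off-B (z∉blk k) (φ→ x)) ⟩
      word (blk k) (φ→ x) ∧ word (blk l) (φ→ x)
        ≡⟨ cong₂ _∧_ (word-φ (blk k) x) (word-φ (blk l) x) ⟩
      Bhat (blk k) x ∧ Bhat (blk l) x ∎
      where open ≡-Reasoning
    meet≡ : count (λ j → not (j == B) ∧ isOne? (vs k j) ∧ isOne? (vs l j))
            ≡ count (λ x → Bhat (blk k) x ∧ Bhat (blk l) x)
    meet≡ = count-words (λ j → not (j == B) ∧ isOne? (vs k j) ∧ isOne? (vs l j))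
                        (λ x → Bhat (blk k) x ∧ Bhat (blk l) x) pointwise

  conclusion : Conclusion D B Bhat z φ
  conclusion = vs , vs∈SB , vs-distinct , (θ , λ k j → refl) , vs-size , vs-replication , vs-meet

lemma3 : (D : Fin 56 → Fin 56 → Bool) → IsBiplane56 D →
    (B : Fin 56) →
    (b : ℕ) → (Bhat : Fin b → Fin 56 → Bool) →
    Is2Design Bhat 12 9 → IsQuasiSymmetric Bhat 0 3 →
    (z : Fin 56) → (φ : Fin 56 ↔ Fin 56) →
    DerivedIsDualResidual D B Bhat z φ →
    Conclusion D B Bhat z φ
lemma3 D biplane B b Bhat design quasi z φ derived =
  Extension.conclusion D biplane B b Bhat design quasi z φ derived
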